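{- Let $M$ be a finite matroid on ground set $E$ with rank function $r$ and set of bases $\mathcal{B}(M)$, and let $E_1,\dots,E_k\subseteq E$ with $k=|E|-r(M)$. Then $\mathcal{B}'[E_1,\dots,E_k]=\mathcal{B}(M)\cap\{E-D: D\in\mathcal{Q}(E_1,\dots,E_k)\}$.
   Context: $N_k=\{1,\dots,k\}$. $\bigvee_{j\in I}E_j$ denotes the set of elements belonging to exactly one of the $E_j$, $j\in I$. $\mathcal{Q}(E_1,\dots,E_k)$ is the set of $k$-element sets $D$ with $D\cap\bigvee_{j\in I}E_j\neq\emptyset$ for every non-empty $I\subseteq N_k$. $\mathcal{B}'[E_1,\dots,E_k]$ is the set of bases $B$ of $M$ such that $B\not\supseteq\bigvee_{i\in I}E_i$ for every non-empty $I\subseteq N_k$. -}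

module Defs where

open import Data.Nat using (ℕ; _≤_; _<_; _∸_)
open import Data.Fin using (Fin)
open import Data.Fin.Subset using (Subset; _∈_; _⊆_; _∪_; ⁅_⁆; ∣_∣; ⊥; Nonempty; ∁)
open import Data.Product using (Σ; ∃; _×_)
open import Relation.Binary.PropositionalEquality using (_≡_)
open import Relation.Nullary using (¬_)

record Matroid (n : ℕ) : Set₁ where
  field
    Indep   : Subset n → Set
    indep-⊥ : Indep ⊥
    indep-⊆ : ∀ {I J} → J ⊆ I → Indep I → Indep J
    augment : ∀ {I J} → Indep I → Indep J → ∣ I ∣ < ∣ J ∣ →
              ∃ λ x → x ∈ J × ¬ (x ∈ I) × Indep (I ∪ ⁅ x ⁆)

open Matroid public

IsBasis : ∀ {n} → Matroid n → Subset n → Set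
IsBasis M B = Indep M B × (∀ I → Indep M I → B ⊆ I → I ≡ B)

IsRankOf : ∀ {n} → Matroid n → ℕ → Set
IsRankOf M r = (∃ λ I → Indep M I × ∣ I ∣ ≡ r) × (∀ I → Indep M I → ∣ I ∣ ≤ r)

-- x ∈ ⋁_{j∈I} E_j : x belongs to E_j for exactly one j ∈ I.
InXor : ∀ {n k} → (Fin k → Subset n) → Subset k → Fin n → Set
InXor Es I x = ∃ λ j → j ∈ I × x ∈ Es j × (∀ j' → j' ∈ I → x ∈ Es j' → j' ≡ j)

InQ : ∀ {n k} → (Fin k → Subset n) → Subset n → Set
InQ {n} {k} Es D = ∣ D ∣ ≡ k ×
  (∀ (I : Subset k) → Nonempty I → ∃ λ x → x ∈ D × InXor Es I x)

InB' : ∀ {n k} → Matroid n → (Fin k → Subset n) → Subset n → Set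
InB' {n} {k} M Es B = IsBasis M B ×
  (∀ (I : Subset k) → Nonempty I → ¬ (∀ x → InXor Es I x → x ∈ B))

-- A basis B of M has exactly r(M) elements, so its complement D = E − B has
-- |E| − r(M) = k elements. The condition defining ℬ' says that no set
-- ⋁_{i∈I} E_i is contained in B, i.e. each of them meets D; this is exactly
-- the condition defining 𝒬 for D. Over the finite ground set, membership in
-- ⋁_{i∈I} E_i is decidable, which turns "not contained in B" into an explicit
-- element of D.
module Submission where

open import Defs
open import Data.Bool.Properties using (not-involutive)
open import Data.Empty using (⊥-elim)
open import Data.Fin using (Fin)
open import Data.Fin.Properties using (any?; all?; ¬∀⟶∃¬) renaming (_≟_ to _≟ᶠ_)
open import Data.Fin.Subset using (Subset; ∁; _∈_; _∉_; ∣_∣; _∪_; ⁅_⁆; Nonempty)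
open import Data.Fin.Subset.Properties
  using (_∈?_; x∈∁p⇒x∉p; x∉p⇒x∈∁p; ∣∁p∣≡n∸∣p∣; x∈⁅x⁆; x∈p∪q⁺)
open import Data.Nat using (ℕ; _∸_; _<_)
open import Data.Nat.Properties using (≤-antisym; ≮⇒≥)
open import Data.Product using (∃; _×_; _,_)
open import Data.Sum using (inj₁; inj₂)
open import Data.Vec.Properties using (map-∘; map-cong; map-id)
open import Function.Bundles using (_⇔_; mk⇔)
open import Relation.Binary.PropositionalEquality using (_≡_; sym; trans; cong; subst)
open import Relation.Nullary using (yes; no; ¬_)
open import Relation.Nullary.Decidable using (_×-dec_; _→-dec_)
open import Relation.Unary using (Pred; Decidable)

∁-involutive : ∀ {n} (p : Subset n) → ∁ (∁ p) ≡ p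
∁-involutive p = trans (sym (map-∘ _ _ p)) (trans (map-cong not-involutive p) (map-id p))

¬⊆⇒∃∈∁ : ∀ {n ℓ} {P : Pred (Fin n) ℓ} → Decidable P → (B : Subset n) →
         ¬ (∀ x → P x → x ∈ B) → ∃ λ x → x ∈ ∁ B × P x
¬⊆⇒∃∈∁ {n} {P = P} P? B P⊈B with ¬∀⟶∃¬ n (λ x → P x → x ∈ B) (λ x → P? x →-dec (x ∈? B)) P⊈B
... | x , Px⇏x∈B with P? x | x ∈? B
...   | yes Px | no x∉B = x , x∉p⇒x∈∁p x∉B , Px
...   | yes Px | yes x∈B = ⊥-elim (Px⇏x∈B (λ _ → x∈B))
...   | no ¬Px | _       = ⊥-elim (Px⇏x∈B (λ Px → ⊥-elim (¬Px Px)))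

inXor? : ∀ {n k} (Es : Fin k → Subset n) (I : Subset k) → Decidable (InXor Es I)
inXor? Es I x = any? λ j → (j ∈? I) ×-dec ((x ∈? Es j) ×-dec
  all? λ j′ → (j′ ∈? I) →-dec ((x ∈? Es j′) →-dec (j′ ≟ᶠ j)))

basis-∪-⁅⁆-dependent : ∀ {n} (M : Matroid n) {B x} → IsBasis M B → x ∉ B →
                       ¬ Indep M (B ∪ ⁅ x ⁆)
basis-∪-⁅⁆-dependent M {B} {x} (_ , maximal) x∉B indep =
  x∉B (subst (x ∈_) (maximal (B ∪ ⁅ x ⁆) indep (λ y∈B → x∈p∪q⁺ (inj₁ y∈B)))
                    (x∈p∪q⁺ (inj₂ (x∈⁅x⁆ x))))

basis-size≡rank : ∀ {n} (M : Matroid n) {r B} → IsRankOf M r → IsBasis M B → ∣ B ∣ ≡ r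
basis-size≡rank M {r} {B} ((I , indep-I , ∣I∣≡r) , bounded) basis@(indep-B , _) =
  ≤-antisym (bounded B indep-B) (≮⇒≥ ¬∣B∣<r)
  where
  ¬∣B∣<r : ¬ (∣ B ∣ < r)
  ¬∣B∣<r ∣B∣<r with augment M indep-B indep-I (subst (∣ B ∣ <_) (sym ∣I∣≡r) ∣B∣<r)
  ... | x , _ , x∉B , indep = basis-∪-⁅⁆-dependent M basis x∉B indep

lemma4p1 : ∀ {n} (M : Matroid n) (r : ℕ) → IsRankOf M r →
    (Es : Fin (n ∸ r) → Subset n) → (B : Subset n) →
    InB' M Es B ⇔ (IsBasis M B × ∃ λ D → InQ Es D × B ≡ ∁ D)
lemma4p1 {n} M r rank Es B = mk⇔ to from
  where
  to : InB' M Es B → IsBasis M B × ∃ λ D → InQ Es D × B ≡ ∁ D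
  to (basis , xors⊈B) = basis , ∁ B , (∣∁B∣≡n∸r , xors-meet-∁B) , sym (∁-involutive B)
    where
    ∣∁B∣≡n∸r : ∣ ∁ B ∣ ≡ n ∸ r
    ∣∁B∣≡n∸r = trans (∣∁p∣≡n∸∣p∣ B) (cong (n ∸_) (basis-size≡rank M rank basis))
    xors-meet-∁B : ∀ I → Nonempty I → ∃ λ x → x ∈ ∁ B × InXor Es I x
    xors-meet-∁B I nonempty = ¬⊆⇒∃∈∁ (inXor? Es I) B (xors⊈B I nonempty)

  from : IsBasis M B × (∃ λ D → InQ Es D × B ≡ ∁ D) → InB' M Es B
  from (basis , D , (_ , xors-meet-D) , B≡∁D) = basis , λ I nonempty xor⊆B →
    let (x , x∈D , x∈xor) = xors-meet-D I nonempty
    in x∈∁p⇒x∉p (subst (x ∈_) B≡∁D (xor⊆B x x∈xor)) x∈D
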